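{- Let $G$ be a 2-connected outerplanar near-triangulation with $V(G)=\{u,v_1,\dots,v_{2k}\}$ ($k\ge1$), $N_G(u)=\{v_1,\dots,v_{2k}\}$ and $\deg_G(v_1)=\deg_G(v_{2k})=2$, where $v_1,\dots,v_{2k}$ are labelled consecutively along the path $G-u$. If $P(G)$ contains a non-vanishing monomial $\eta\, u^{\alpha_u}\prod_{i=1}^{2k}v_i^{\alpha_i}$, then $P(G)$ also contains the monomial $-\eta\, u^{\alpha_u}\prod_{i=1}^{2k}v_i^{\alpha_{2k-i+1}}$.
   Context: For a graph $G$, vertices are also variables and $P(G)=\prod_{xy\in E(G),\,x<y}(x-y)$ for a fixed arbitrary orientation (changing it only multiplies $P(G)$ by $\pm1$). "$P(G)$ contains $\eta M$" means the coefficient of $M$ is $\eta$; non-vanishing means $\eta\neq0$. A 2-connected outerplanar near-triangulation is a 2-connected outerplanar graph embedded with all vertices on the outer cycle and all bounded faces triangles. -}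

module Defs where

open import Data.Nat using (ℕ; zero; suc; _+_)
open import Data.Integer using (ℤ; +_; -_) renaming (_*_ to _*ℤ_; _+_ to _+ℤ_)
open import Data.Fin using (Fin; zero; suc)
open import Data.Vec using (Vec; []; _∷_; zipWith; replicate)
import Data.Vec.Properties as VP
import Data.Nat.Properties as NP
open import Data.List using (List; []; _∷_; _++_; map; concatMap; foldr; allFin)
open import Data.Product using (_×_; _,_)
open import Relation.Nullary using (yes; no)

Monomial : ℕ → Set
Monomial m = Vec ℕ m

-- Polynomials with integer coefficients, as (not necessarily normalised)
-- formal sums of terms  c · x^e.
Poly : ℕ → Set
Poly m = List (ℤ × Monomial m)

coeff : ∀ {m} → Poly m → Monomial m → ℤ
coeff [] e = + 0
coeff ((c , e′) ∷ p) e with VP.≡-dec NP._≟_ e′ e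
... | yes _ = c +ℤ coeff p e
... | no  _ = coeff p e

unitExp : ∀ {m} → Fin m → Monomial m
unitExp {suc m} zero    = 1 ∷ replicate m 0
unitExp {suc m} (suc i) = 0 ∷ unitExp i

var : ∀ {m} → Fin m → Poly m
var i = (+ 1 , unitExp i) ∷ []

neg : ∀ {m} → Poly m → Poly m
neg = map (λ { (c , e) → (- c , e) })

_−_ : ∀ {m} → Poly m → Poly m → Poly m
p − q = p ++ neg q

one : ∀ {m} → Poly m
one = (+ 1 , replicate _ 0) ∷ []

_⊗_ : ∀ {m} → Poly m → Poly m → Poly m
p ⊗ q = concatMap (λ { (c , e) → map (λ { (d , f) → (c *ℤ d , zipWith _+_ e f) }) q }) p

prod : ∀ {m} → List (Poly m) → Poly m
prod = foldr _⊗_ one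

graphPoly : ∀ {m} → List (Fin m × Fin m) → Poly m
graphPoly E = prod (map (λ { (x , y) → var x − var y }) E)

pathEdges : (n : ℕ) → List (Fin n × Fin n)
pathEdges zero = []
pathEdges (suc zero) = []
pathEdges (suc (suc n)) = (zero , suc zero) ∷ map (λ { (a , b) → (suc a , suc b) }) (pathEdges (suc n))

-- The graph G on vertex set Fin (suc n): vertex 0 is u, vertex (suc i) is v_{i+1}.
-- Edges: u v_i for all i, and v_i v_{i+1} (the path G − u).
fanEdges : (n : ℕ) → List (Fin (suc n) × Fin (suc n))
fanEdges n = map (λ i → (zero , suc i)) (allFin n)
          ++ map (λ { (a , b) → (suc a , suc b) }) (pathEdges n)

fanPoly : (n : ℕ) → Poly (suc n)
fanPoly n = graphPoly (fanEdges n)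

{-# OPTIONS --safe #-}
module Submission where

-- Fixing u and reflecting the path, vᵢ ↦ v₂ₖ₊₁₋ᵢ, is an automorphism of G. Substituting it
-- into P(G) permutes the spoke factors u − vᵢ and sends each of the 2k − 1 path factors
-- vᵢ − vᵢ₊₁ to a path factor of the opposite orientation. Hence the substitution maps P(G)
-- to (−1)^(2k−1) P(G) = −P(G), and comparing coefficients gives the claim.

open import Defs
open import Data.Nat using (ℕ; _*_; _≤_)
open import Data.Integer using (ℤ; +_; -_)
open import Data.Vec using (Vec; _∷_; reverse)
open import Relation.Binary.PropositionalEquality using (_≡_; _≢_)

import Data.Nat as ℕ
import Data.Nat.Properties as ℕ
import Data.Integer as ℤ
import Data.Integer.Properties as ℤ
open import Data.Nat using (zero; suc)
open import Data.Fin using (Fin; zero; suc; opposite; fromℕ; inject₁)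
open import Data.Vec as Vec using ([]; zipWith; replicate; _∷ʳ_)
import Data.Vec.Properties as Vec
open import Data.Vec.Relation.Binary.Pointwise.Inductive using (Pointwise; []; _∷_)
import Data.Vec.Relation.Binary.Pointwise.Inductive as Pointwise
open import Data.List as List using (List; []; _∷_; _++_; map; concatMap; tabulate; allFin; length)
import Data.List.Properties as List
open import Data.List.Relation.Binary.Permutation.Propositional as ↭ using (_↭_; prep; swap; ↭-trans; ↭-reflexive)
open import Data.List.Relation.Binary.Permutation.Propositional.Properties using (map⁺; ++⁺; ↭-reverse)
open import Data.Product as Product using (_×_; _,_; map₂) renaming (swap to flip)
open import Function using (_∘_; id)
open import Relation.Nullary using (Dec; yes; no; ¬_; contradiction)
open import Algebra.Properties.CommutativeSemigroup ℤ.+-commutativeSemigroup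
  using () renaming (interchange to +-interchange)
open import Relation.Binary.PropositionalEquality using (refl; sym; trans; cong; cong₂; _≗_; module ≡-Reasoning)

private variable
  A B : Set
  m n : ℕ

-- Sums over lists

∑ : List A → (A → ℤ) → ℤ
∑ []       f = + 0
∑ (x ∷ xs) f = f x ℤ.+ ∑ xs f

infix 5 ∑
syntax ∑ xs (λ x → t) = ∑[ x ∈ xs ] t

∑-cong : ∀ (xs : List A) {f g : A → ℤ} → f ≗ g → ∑ xs f ≡ ∑ xs g
∑-cong []       f≗g = refl
∑-cong (x ∷ xs) f≗g = cong₂ ℤ._+_ (f≗g x) (∑-cong xs f≗g)

∑-zero : ∀ (xs : List A) → ∑[ x ∈ xs ] + 0 ≡ + 0
∑-zero []       = refl
∑-zero (x ∷ xs) = trans (ℤ.+-identityˡ _) (∑-zero xs)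

∑-++ : ∀ (xs ys : List A) (f : A → ℤ) → ∑ (xs ++ ys) f ≡ ∑ xs f ℤ.+ ∑ ys f
∑-++ []       ys f = sym (ℤ.+-identityˡ _)
∑-++ (x ∷ xs) ys f = trans (cong (ℤ._+_ (f x)) (∑-++ xs ys f)) (sym (ℤ.+-assoc (f x) _ _))

∑-map : ∀ (g : A → B) (xs : List A) (f : B → ℤ) → ∑ (map g xs) f ≡ ∑ xs (f ∘ g)
∑-map g []       f = refl
∑-map g (x ∷ xs) f = cong (ℤ._+_ (f (g x))) (∑-map g xs f)

∑-concatMap : ∀ (g : A → List B) (xs : List A) (f : B → ℤ) →
              ∑ (concatMap g xs) f ≡ ∑[ x ∈ xs ] ∑ (g x) f
∑-concatMap g []       f = refl
∑-concatMap g (x ∷ xs) f = trans (∑-++ (g x) (concatMap g xs) f) (cong (ℤ._+_ (∑ (g x) f)) (∑-concatMap g xs f))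

∑-+ : ∀ (xs : List A) (f g : A → ℤ) → ∑[ x ∈ xs ] (f x ℤ.+ g x) ≡ ∑ xs f ℤ.+ ∑ xs g
∑-+ []       f g = refl
∑-+ (x ∷ xs) f g = trans (cong (ℤ._+_ (f x ℤ.+ g x)) (∑-+ xs f g)) (+-interchange (f x) (g x) _ _)

∑-comm : ∀ (xs : List A) (ys : List B) (F : A → B → ℤ) →
         ∑[ x ∈ xs ] ∑[ y ∈ ys ] F x y ≡ ∑[ y ∈ ys ] ∑[ x ∈ xs ] F x y
∑-comm []       ys F = sym (∑-zero ys)
∑-comm (x ∷ xs) ys F = trans (cong (ℤ._+_ (∑ ys (F x))) (∑-comm xs ys F))
                             (sym (∑-+ ys (F x) (λ y → ∑[ x ∈ xs ] F x y)))

∑-neg : ∀ (xs : List A) (f : A → ℤ) → ∑[ x ∈ xs ] ℤ.- f x ≡ ℤ.- ∑ xs f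
∑-neg []       f = refl
∑-neg (x ∷ xs) f = trans (cong (ℤ._+_ (ℤ.- f x)) (∑-neg xs f)) (sym (ℤ.neg-distrib-+ (f x) _))

∑-*ˡ : ∀ (c : ℤ) (xs : List A) (f : A → ℤ) → ∑[ x ∈ xs ] c ℤ.* f x ≡ c ℤ.* ∑ xs f
∑-*ˡ c []       f = sym (ℤ.*-zeroʳ c)
∑-*ˡ c (x ∷ xs) f = trans (cong (ℤ._+_ (c ℤ.* f x)) (∑-*ˡ c xs f)) (sym (ℤ.*-distribˡ-+ c (f x) _))

-- Coefficients of products

Term : ℕ → Set
Term m = ℤ × Monomial m

infixl 6 _⊕_ _⊖_
infix 4 _≼_ _≼?_ _≟ₘ_

_⊕_ : Monomial m → Monomial m → Monomial m
_⊕_ = zipWith ℕ._+_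

_⊖_ : Monomial m → Monomial m → Monomial m
_⊖_ = zipWith ℕ._∸_

_≼_ : Monomial m → Monomial m → Set
_≼_ = Pointwise ℕ._≤_

_≼?_ : (a e : Monomial m) → Dec (a ≼ e)
_≼?_ = Pointwise.decidable ℕ._≤?_

_≟ₘ_ : (a e : Monomial m) → Dec (a ≡ e)
_≟ₘ_ = Vec.≡-dec ℕ._≟_

≼-⊕ : (a b : Monomial m) → a ≼ a ⊕ b
≼-⊕ []       []       = []
≼-⊕ (x ∷ a) (y ∷ b) = ℕ.m≤m+n x y ∷ ≼-⊕ a b

⊕-⊖-cancel : (a b : Monomial m) → (a ⊕ b) ⊖ a ≡ b
⊕-⊖-cancel []       []       = refl
⊕-⊖-cancel (x ∷ a) (y ∷ b) = cong₂ _∷_ (ℕ.m+n∸m≡n x y) (⊕-⊖-cancel a b)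

⊕-⊖ : {a e : Monomial m} → a ≼ e → a ⊕ (e ⊖ a) ≡ e
⊕-⊖ []           = refl
⊕-⊖ (x≤y ∷ a≼e) = cong₂ _∷_ (ℕ.m+[n∸m]≡n x≤y) (⊕-⊖ a≼e)

⊕≡⇒≼ : {a b e : Monomial m} → a ⊕ b ≡ e → a ≼ e
⊕≡⇒≼ {a = a} {b} refl = ≼-⊕ a b

⊕≡⇒≡⊖ : {a b e : Monomial m} → a ⊕ b ≡ e → b ≡ e ⊖ a
⊕≡⇒≡⊖ {a = a} {b} refl = sym (⊕-⊖-cancel a b)

≡⊖⇒⊕≡ : {a b e : Monomial m} → a ≼ e → b ≡ e ⊖ a → a ⊕ b ≡ e
≡⊖⇒⊕≡ a≼e refl = ⊕-⊖ a≼e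

infixl 7 _⊙_

_⊙_ : Term m → Term m → Term m
(c , a) ⊙ (d , b) = c ℤ.* d , a ⊕ b

⊙-comm : (t s : Term m) → t ⊙ s ≡ s ⊙ t
⊙-comm (c , a) (d , b) = cong₂ _,_ (ℤ.*-comm c d) (Vec.zipWith-comm ℕ.+-comm a b)

⊙-assoc : (t s r : Term m) → (t ⊙ s) ⊙ r ≡ t ⊙ (s ⊙ r)
⊙-assoc (c , a) (d , b) (f , g) = cong₂ _,_ (ℤ.*-assoc c d f) (Vec.zipWith-assoc ℕ.+-assoc a b g)

-- This holds on the nose, not only coefficientwise: both sides list the products
-- t ⊙ s ⊙ u in the same order.
⊗-assoc : (p q r : Poly m) → (p ⊗ q) ⊗ r ≡ p ⊗ (q ⊗ r)
⊗-assoc []      q r = refl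
⊗-assoc (t ∷ p) q r = begin
  (map (t ⊙_) q ++ p ⊗ q) ⊗ r           ≡⟨ List.concatMap-++ _ (map (t ⊙_) q) (p ⊗ q) ⟩
  map (t ⊙_) q ⊗ r ++ (p ⊗ q) ⊗ r        ≡⟨ cong₂ _++_ scaled-row (⊗-assoc p q r) ⟩
  map (t ⊙_) (q ⊗ r) ++ p ⊗ (q ⊗ r)      ∎
  where
  open ≡-Reasoning
  scaled-row : map (t ⊙_) q ⊗ r ≡ map (t ⊙_) (q ⊗ r)
  scaled-row = begin
    concatMap (λ s → map (s ⊙_) r) (map (t ⊙_) q)     ≡⟨ List.concatMap-map _ (t ⊙_) q ⟩
    concatMap (λ s → map ((t ⊙ s) ⊙_) r) q             ≡⟨ List.concatMap-cong (λ s → List.map-cong (⊙-assoc t s) r) q ⟩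
    concatMap (λ s → map (λ u → t ⊙ (s ⊙ u)) r) q     ≡⟨ List.concatMap-cong (λ s → List.map-∘ r) q ⟩
    concatMap (λ s → map (t ⊙_) (map (s ⊙_) r)) q      ≡⟨ List.map-concatMap (t ⊙_) _ q ⟨
    map (t ⊙_) (q ⊗ r)                                  ∎

when : {P : Set} → Dec P → ℤ → ℤ
when (yes _) c = c
when (no _)  c = + 0

when-⇔ : {P Q : Set} → (P → Q) → (Q → P) → (p? : Dec P) (q? : Dec Q) (c : ℤ) → when p? c ≡ when q? c
when-⇔ P→Q Q→P (yes p) (yes q) c = refl
when-⇔ P→Q Q→P (yes p) (no ¬q) c = contradiction (P→Q p) ¬q
when-⇔ P→Q Q→P (no ¬p) (yes q) c = contradiction (Q→P q) ¬p
when-⇔ P→Q Q→P (no ¬p) (no ¬q) c = refl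

when-no : {P : Set} → ¬ P → (p? : Dec P) (c : ℤ) → when p? c ≡ + 0
when-no ¬p (yes p) c = contradiction p ¬p
when-no ¬p (no _)  c = refl

*-when : {P : Set} (c : ℤ) (p? : Dec P) (d : ℤ) → c ℤ.* when p? d ≡ when p? (c ℤ.* d)
*-when c (yes _) d = refl
*-when c (no _)  d = ℤ.*-zeroʳ c

coeffAt : Monomial m → Term m → ℤ
coeffAt e (c , a) = when (a ≟ₘ e) c

coeff-∑ : (p : Poly m) (e : Monomial m) → coeff p e ≡ ∑ p (coeffAt e)
coeff-∑ []            e = refl
coeff-∑ ((c , a) ∷ p) e with a ≟ₘ e
... | yes _ = cong (ℤ._+_ c) (coeff-∑ p e)
... | no  _ = trans (coeff-∑ p e) (sym (ℤ.+-identityˡ _))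

∑-⊗ : (p q : Poly m) (f : Term m → ℤ) → ∑ (p ⊗ q) f ≡ ∑[ t ∈ p ] ∑[ s ∈ q ] f (t ⊙ s)
∑-⊗ p q f = trans (∑-concatMap _ p f) (∑-cong p (λ t → ∑-map (t ⊙_) q f))

coeffShift : Monomial m → Poly m → Monomial m → ℤ
coeffShift a q e = when (a ≼? e) (coeff q (e ⊖ a))

∑-coeffAt-⊙ : (c : ℤ) (a : Monomial m) (q : Poly m) (e : Monomial m) →
              ∑[ s ∈ q ] coeffAt e ((c , a) ⊙ s) ≡ c ℤ.* coeffShift a q e
∑-coeffAt-⊙ c a q e with a ≼? e
... | yes a≼e = begin
  ∑[ s ∈ q ] coeffAt e ((c , a) ⊙ s)     ≡⟨ ∑-cong q term ⟩
  ∑[ s ∈ q ] c ℤ.* coeffAt (e ⊖ a) s      ≡⟨ ∑-*ˡ c q _ ⟩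
  c ℤ.* ∑ q (coeffAt (e ⊖ a))            ≡⟨ cong (c ℤ.*_) (coeff-∑ q (e ⊖ a)) ⟨
  c ℤ.* coeff q (e ⊖ a)                  ∎
  where
  open ≡-Reasoning
  term : (s : Term _) → coeffAt e ((c , a) ⊙ s) ≡ c ℤ.* coeffAt (e ⊖ a) s
  term (d , b) = trans (when-⇔ ⊕≡⇒≡⊖ (≡⊖⇒⊕≡ a≼e) (a ⊕ b ≟ₘ e) (b ≟ₘ e ⊖ a) (c ℤ.* d))
                       (sym (*-when c (b ≟ₘ e ⊖ a) d))
... | no a⋠e = begin
  ∑[ s ∈ q ] coeffAt e ((c , a) ⊙ s)     ≡⟨ ∑-cong q (λ (d , b) → when-no (a⋠e ∘ ⊕≡⇒≼) (a ⊕ b ≟ₘ e) (c ℤ.* d)) ⟩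
  ∑[ s ∈ q ] + 0                         ≡⟨ ∑-zero q ⟩
  + 0                                    ≡⟨ ℤ.*-zeroʳ c ⟨
  c ℤ.* + 0                              ∎
  where open ≡-Reasoning

coeff-⊗ : (p q : Poly m) (e : Monomial m) → coeff (p ⊗ q) e ≡ ∑ p (λ (c , a) → c ℤ.* coeffShift a q e)
coeff-⊗ p q e = trans (trans (coeff-∑ (p ⊗ q) e) (∑-⊗ p q (coeffAt e)))
                      (∑-cong p (λ (c , a) → ∑-coeffAt-⊙ c a q e))

-- Graph polynomials up to sign

neg^ : ℕ → ℤ → ℤ
neg^ zero    x = x
neg^ (suc k) x = ℤ.- neg^ k x

neg^-zero : (k : ℕ) → neg^ k (+ 0) ≡ + 0
neg^-zero zero    = refl
neg^-zero (suc k) = cong ℤ.-_ (neg^-zero k)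

*-neg^ : (c : ℤ) (k : ℕ) (x : ℤ) → c ℤ.* neg^ k x ≡ neg^ k (c ℤ.* x)
*-neg^ c zero    x = refl
*-neg^ c (suc k) x = trans (sym (ℤ.neg-distribʳ-* c (neg^ k x))) (cong ℤ.-_ (*-neg^ c k x))

∑-neg^ : (k : ℕ) (xs : List A) (f : A → ℤ) → ∑[ x ∈ xs ] neg^ k (f x) ≡ neg^ k (∑ xs f)
∑-neg^ zero    xs f = refl
∑-neg^ (suc k) xs f = trans (∑-neg xs (neg^ k ∘ f)) (cong ℤ.-_ (∑-neg^ k xs f))

neg^-even : (k : ℕ) (x : ℤ) → neg^ (2 * k) x ≡ x
neg^-even zero    x = refl
neg^-even (suc k) x = begin
  ℤ.- neg^ (k ℕ.+ suc (k ℕ.+ 0)) x  ≡⟨ cong (λ j → ℤ.- neg^ j x) (ℕ.+-suc k (k ℕ.+ 0)) ⟩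
  ℤ.- ℤ.- neg^ (2 * k) x            ≡⟨ ℤ.neg-involutive _ ⟩
  neg^ (2 * k) x                    ≡⟨ neg^-even k x ⟩
  x                                 ∎
  where open ≡-Reasoning

neg^-odd : (k : ℕ) → 1 ≤ k → (x : ℤ) → neg^ (2 * k ℕ.∸ 1) x ≡ ℤ.- x
neg^-odd (suc k) _ x = begin
  neg^ (k ℕ.+ suc (k ℕ.+ 0)) x  ≡⟨ cong (λ j → neg^ j x) (ℕ.+-suc k (k ℕ.+ 0)) ⟩
  ℤ.- neg^ (2 * k) x            ≡⟨ cong ℤ.-_ (neg^-even k x) ⟩
  ℤ.- x                         ∎
  where open ≡-Reasoning

infix 4 _≈[_]_ _≈_

record _≈[_]_ (p : Poly m) (k : ℕ) (q : Poly m) : Set where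
  field coeff-≈ : (e : Monomial m) → coeff p e ≡ neg^ k (coeff q e)

open _≈[_]_

_≈_ : Poly m → Poly m → Set
p ≈ q = p ≈[ 0 ] q

⊗-comm : (p q : Poly m) → p ⊗ q ≈ q ⊗ p
⊗-comm p q .coeff-≈ e = begin
  coeff (p ⊗ q) e                              ≡⟨ trans (coeff-∑ (p ⊗ q) e) (∑-⊗ p q (coeffAt e)) ⟩
  ∑[ t ∈ p ] ∑[ s ∈ q ] coeffAt e (t ⊙ s)      ≡⟨ ∑-comm p q _ ⟩
  ∑[ s ∈ q ] ∑[ t ∈ p ] coeffAt e (t ⊙ s)      ≡⟨ ∑-cong q (λ s → ∑-cong p (λ t → cong (coeffAt e) (⊙-comm t s))) ⟩
  ∑[ s ∈ q ] ∑[ t ∈ p ] coeffAt e (s ⊙ t)      ≡⟨ trans (coeff-∑ (q ⊗ p) e) (∑-⊗ q p (coeffAt e)) ⟨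
  coeff (q ⊗ p) e                              ∎
  where open ≡-Reasoning

⊗-congʳ : (p : Poly m) {q r : Poly m} {k : ℕ} → q ≈[ k ] r → p ⊗ q ≈[ k ] p ⊗ r
⊗-congʳ p {q} {r} {k} q≈r .coeff-≈ e = begin
  coeff (p ⊗ q) e                                       ≡⟨ coeff-⊗ p q e ⟩
  ∑ p (λ (c , a) → c ℤ.* coeffShift a q e)              ≡⟨ ∑-cong p (λ (c , a) → trans (cong (c ℤ.*_) (shift a)) (*-neg^ c k _)) ⟩
  ∑ p (λ (c , a) → neg^ k (c ℤ.* coeffShift a r e))     ≡⟨ ∑-neg^ k p _ ⟩
  neg^ k (∑ p (λ (c , a) → c ℤ.* coeffShift a r e))     ≡⟨ cong (neg^ k) (coeff-⊗ p r e) ⟨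
  neg^ k (coeff (p ⊗ r) e)                              ∎
  where
  open ≡-Reasoning
  shift : (a : Monomial _) → coeffShift a q e ≡ neg^ k (coeffShift a r e)
  shift a with a ≼? e
  ... | yes _ = q≈r .coeff-≈ (e ⊖ a)
  ... | no  _ = sym (neg^-zero k)

⊗-congˡ : {p q : Poly m} (r : Poly m) {k : ℕ} → p ≈[ k ] q → p ⊗ r ≈[ k ] q ⊗ r
⊗-congˡ {p = p} {q} r {k} p≈q .coeff-≈ e = begin
  coeff (p ⊗ r) e            ≡⟨ ⊗-comm p r .coeff-≈ e ⟩
  coeff (r ⊗ p) e            ≡⟨ ⊗-congʳ r p≈q .coeff-≈ e ⟩
  neg^ k (coeff (r ⊗ q) e)   ≡⟨ cong (neg^ k) (⊗-comm r q .coeff-≈ e) ⟩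
  neg^ k (coeff (q ⊗ r) e)   ∎
  where open ≡-Reasoning

prod-↭ : {xs ys : List (Poly m)} → xs ↭ ys → prod xs ≈ prod ys
prod-↭ ↭.refl         .coeff-≈ e = refl
prod-↭ (prep p xs↭ys) = ⊗-congʳ p (prod-↭ xs↭ys)
prod-↭ {xs = p ∷ q ∷ xs} {q ∷ p ∷ ys} (swap p q xs↭ys) .coeff-≈ e = begin
  coeff (p ⊗ (q ⊗ prod xs)) e   ≡⟨ ⊗-congʳ p (⊗-congʳ q (prod-↭ xs↭ys)) .coeff-≈ e ⟩
  coeff (p ⊗ (q ⊗ prod ys)) e   ≡⟨ cong (λ r → coeff r e) (⊗-assoc p q (prod ys)) ⟨
  coeff ((p ⊗ q) ⊗ prod ys) e   ≡⟨ ⊗-congˡ (prod ys) (⊗-comm p q) .coeff-≈ e ⟩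
  coeff ((q ⊗ p) ⊗ prod ys) e   ≡⟨ cong (λ r → coeff r e) (⊗-assoc q p (prod ys)) ⟩
  coeff (q ⊗ (p ⊗ prod ys)) e   ∎
  where open ≡-Reasoning
prod-↭ (↭.trans xs↭ys ys↭zs) .coeff-≈ e = trans (prod-↭ xs↭ys .coeff-≈ e) (prod-↭ ys↭zs .coeff-≈ e)

edgeFactor : Fin m × Fin m → Poly m
edgeFactor (x , y) = var x − var y

edgeFactor-flip : (xy : Fin m × Fin m) → edgeFactor (flip xy) ≈[ 1 ] edgeFactor xy
edgeFactor-flip (x , y) .coeff-≈ e = begin
  coeff (edgeFactor (y , x)) e            ≡⟨ coeff-∑ (edgeFactor (y , x)) e ⟩
  ∑ (edgeFactor (y , x)) (coeffAt e)      ≡⟨ antisymmetric (unitExp y ≟ₘ e) (unitExp x ≟ₘ e) ⟩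
  ℤ.- ∑ (edgeFactor (x , y)) (coeffAt e)  ≡⟨ cong ℤ.-_ (coeff-∑ (edgeFactor (x , y)) e) ⟨
  ℤ.- coeff (edgeFactor (x , y)) e        ∎
  where
  open ≡-Reasoning
  antisymmetric : {P Q : Set} (p? : Dec P) (q? : Dec Q) →
    when p? (+ 1) ℤ.+ (when q? (ℤ.- + 1) ℤ.+ + 0) ≡ ℤ.- (when q? (+ 1) ℤ.+ (when p? (ℤ.- + 1) ℤ.+ + 0))
  antisymmetric (yes _) (yes _) = refl
  antisymmetric (yes _) (no  _) = refl
  antisymmetric (no  _) (yes _) = refl
  antisymmetric (no  _) (no  _) = refl

graphPoly-↭ : {E F : List (Fin m × Fin m)} → E ↭ F → graphPoly E ≈ graphPoly F
graphPoly-↭ E↭F = prod-↭ (map⁺ edgeFactor E↭F)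

graphPoly-flip : (E F : List (Fin m × Fin m)) → graphPoly (E ++ map flip F) ≈[ length F ] graphPoly (E ++ F)
graphPoly-flip (xy ∷ E) F                 = ⊗-congʳ (edgeFactor xy) (graphPoly-flip E F)
graphPoly-flip []       []       .coeff-≈ e = refl
graphPoly-flip []       (xy ∷ F) .coeff-≈ e = begin
  coeff (edgeFactor (flip xy) ⊗ graphPoly (map flip F)) e
    ≡⟨ ⊗-congˡ (graphPoly (map flip F)) (edgeFactor-flip xy) .coeff-≈ e ⟩
  ℤ.- coeff (edgeFactor xy ⊗ graphPoly (map flip F)) e
    ≡⟨ cong ℤ.-_ (⊗-congʳ (edgeFactor xy) (graphPoly-flip [] F) .coeff-≈ e) ⟩
  ℤ.- neg^ (length F) (coeff (edgeFactor xy ⊗ graphPoly F) e)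
    ∎
  where open ≡-Reasoning

-- Reflecting the rim of the fan

zipWith-∷ʳ : ∀ {C : Set} (f : A → B → C) (xs : Vec A n) (ys : Vec B n) x y →
             zipWith f (xs ∷ʳ x) (ys ∷ʳ y) ≡ zipWith f xs ys ∷ʳ f x y
zipWith-∷ʳ f []       []       x y = refl
zipWith-∷ʳ f (a ∷ xs) (b ∷ ys) x y = cong (f a b ∷_) (zipWith-∷ʳ f xs ys x y)

reverse-zipWith : ∀ {C : Set} (f : A → B → C) (xs : Vec A n) (ys : Vec B n) →
                  reverse (zipWith f xs ys) ≡ zipWith f (reverse xs) (reverse ys)
reverse-zipWith f []       []       = refl
reverse-zipWith f (x ∷ xs) (y ∷ ys) = begin
  reverse (f x y ∷ zipWith f xs ys)                   ≡⟨ Vec.reverse-∷ (f x y) (zipWith f xs ys) ⟩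
  reverse (zipWith f xs ys) ∷ʳ f x y                  ≡⟨ cong (_∷ʳ f x y) (reverse-zipWith f xs ys) ⟩
  zipWith f (reverse xs) (reverse ys) ∷ʳ f x y        ≡⟨ zipWith-∷ʳ f (reverse xs) (reverse ys) x y ⟨
  zipWith f (reverse xs ∷ʳ x) (reverse ys ∷ʳ y)      ≡⟨ cong₂ (zipWith f) (Vec.reverse-∷ x xs) (Vec.reverse-∷ y ys) ⟨
  zipWith f (reverse (x ∷ xs)) (reverse (y ∷ ys))     ∎
  where open ≡-Reasoning

replicate-∷ʳ : ∀ n (x : A) → replicate n x ∷ʳ x ≡ x ∷ replicate n x
replicate-∷ʳ zero    x = refl
replicate-∷ʳ (suc n) x = cong (x ∷_) (replicate-∷ʳ n x)

reverse-replicate : ∀ n (x : A) → reverse (replicate n x) ≡ replicate n x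
reverse-replicate zero    x = refl
reverse-replicate (suc n) x = begin
  reverse (x ∷ replicate n x)   ≡⟨ Vec.reverse-∷ x (replicate n x) ⟩
  reverse (replicate n x) ∷ʳ x  ≡⟨ cong (_∷ʳ x) (reverse-replicate n x) ⟩
  replicate n x ∷ʳ x            ≡⟨ replicate-∷ʳ n x ⟩
  x ∷ replicate n x             ∎
  where open ≡-Reasoning

unitExp-fromℕ : ∀ n → unitExp (fromℕ n) ≡ replicate n 0 ∷ʳ 1
unitExp-fromℕ zero    = refl
unitExp-fromℕ (suc n) = cong (0 ∷_) (unitExp-fromℕ n)

unitExp-inject₁ : (i : Fin n) → unitExp (inject₁ i) ≡ unitExp i ∷ʳ 0
unitExp-inject₁ {suc n} zero    = cong (1 ∷_) (sym (replicate-∷ʳ n 0))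
unitExp-inject₁         (suc i) = cong (0 ∷_) (unitExp-inject₁ i)

reverse-unitExp : (i : Fin n) → reverse (unitExp i) ≡ unitExp (opposite i)
reverse-unitExp {suc n} zero = begin
  reverse (1 ∷ replicate n 0)   ≡⟨ Vec.reverse-∷ 1 (replicate n 0) ⟩
  reverse (replicate n 0) ∷ʳ 1  ≡⟨ cong (_∷ʳ 1) (reverse-replicate n 0) ⟩
  replicate n 0 ∷ʳ 1            ≡⟨ unitExp-fromℕ n ⟨
  unitExp (fromℕ n)             ∎
  where open ≡-Reasoning
reverse-unitExp (suc i) = begin
  reverse (0 ∷ unitExp i)              ≡⟨ Vec.reverse-∷ 0 (unitExp i) ⟩
  reverse (unitExp i) ∷ʳ 0             ≡⟨ cong (_∷ʳ 0) (reverse-unitExp i) ⟩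
  unitExp (opposite i) ∷ʳ 0            ≡⟨ unitExp-inject₁ (opposite i) ⟨
  unitExp (inject₁ (opposite i))       ∎
  where open ≡-Reasoning

mirror : Monomial (suc n) → Monomial (suc n)
mirror (x ∷ v) = x ∷ reverse v

mirrorVertex : Fin (suc n) → Fin (suc n)
mirrorVertex zero    = zero
mirrorVertex (suc i) = suc (opposite i)

mirror-involutive : (e : Monomial (suc n)) → mirror (mirror e) ≡ e
mirror-involutive (x ∷ v) = cong (x ∷_) (Vec.reverse-involutive v)

mirror-⊕ : (a b : Monomial (suc n)) → mirror (a ⊕ b) ≡ mirror a ⊕ mirror b
mirror-⊕ (x ∷ a) (y ∷ b) = cong (x ℕ.+ y ∷_) (reverse-zipWith ℕ._+_ a b)

mirror-unitExp : (i : Fin (suc n)) → mirror (unitExp i) ≡ unitExp (mirrorVertex i)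
mirror-unitExp {n} zero = cong (1 ∷_) (reverse-replicate n 0)
mirror-unitExp (suc i)  = cong (0 ∷_) (reverse-unitExp i)

mirror-replicate : mirror (replicate (suc n) 0) ≡ replicate (suc n) 0
mirror-replicate {n} = cong (0 ∷_) (reverse-replicate n 0)

mirrorTerm : Term (suc n) → Term (suc n)
mirrorTerm = map₂ mirror

mirrorPoly : Poly (suc n) → Poly (suc n)
mirrorPoly = map mirrorTerm

coeff-mirrorPoly : (p : Poly (suc n)) (e : Monomial (suc n)) → coeff (mirrorPoly p) e ≡ coeff p (mirror e)
coeff-mirrorPoly p e = begin
  coeff (mirrorPoly p) e                ≡⟨ coeff-∑ (mirrorPoly p) e ⟩
  ∑ (mirrorPoly p) (coeffAt e)          ≡⟨ ∑-map mirrorTerm p (coeffAt e) ⟩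
  ∑ p (coeffAt e ∘ mirrorTerm)          ≡⟨ ∑-cong p (λ (c , a) → when-⇔ (mirror⇒ a) (⇐mirror a) (mirror a ≟ₘ e) (a ≟ₘ mirror e) c) ⟩
  ∑ p (coeffAt (mirror e))              ≡⟨ coeff-∑ p (mirror e) ⟨
  coeff p (mirror e)                    ∎
  where
  open ≡-Reasoning
  mirror⇒ : ∀ a → mirror a ≡ e → a ≡ mirror e
  mirror⇒ a ma≡e = trans (sym (mirror-involutive a)) (cong mirror ma≡e)
  ⇐mirror : ∀ a → a ≡ mirror e → mirror a ≡ e
  ⇐mirror a a≡me = trans (cong mirror a≡me) (mirror-involutive e)

mirrorTerm-⊙ : (t s : Term (suc n)) → mirrorTerm (t ⊙ s) ≡ mirrorTerm t ⊙ mirrorTerm s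
mirrorTerm-⊙ (c , a) (d , b) = cong (c ℤ.* d ,_) (mirror-⊕ a b)

mirrorPoly-⊗ : (p q : Poly (suc n)) → mirrorPoly (p ⊗ q) ≡ mirrorPoly p ⊗ mirrorPoly q
mirrorPoly-⊗ p q = begin
  map mirrorTerm (concatMap (λ t → map (t ⊙_) q) p)                        ≡⟨ List.map-concatMap mirrorTerm _ p ⟩
  concatMap (λ t → map mirrorTerm (map (t ⊙_) q)) p                         ≡⟨ List.concatMap-cong row p ⟩
  concatMap (λ t → map (mirrorTerm t ⊙_) (mirrorPoly q)) p                  ≡⟨ List.concatMap-map _ mirrorTerm p ⟨
  concatMap (λ t → map (t ⊙_) (mirrorPoly q)) (mirrorPoly p)                ∎
  where
  open ≡-Reasoning
  row : ∀ t → map mirrorTerm (map (t ⊙_) q) ≡ map (mirrorTerm t ⊙_) (mirrorPoly q)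
  row t = trans (sym (List.map-∘ q)) (trans (List.map-cong (mirrorTerm-⊙ t) q) (List.map-∘ q))

mirrorEdge : Fin (suc n) × Fin (suc n) → Fin (suc n) × Fin (suc n)
mirrorEdge = Product.map mirrorVertex mirrorVertex

mirrorPoly-graphPoly : (E : List (Fin (suc n) × Fin (suc n))) →
                       mirrorPoly (graphPoly E) ≡ graphPoly (map mirrorEdge E)
mirrorPoly-graphPoly []            = cong (λ z → (+ 1 , z) ∷ []) mirror-replicate
mirrorPoly-graphPoly ((x , y) ∷ E) = begin
  mirrorPoly (edgeFactor (x , y) ⊗ graphPoly E)                    ≡⟨ mirrorPoly-⊗ (edgeFactor (x , y)) (graphPoly E) ⟩
  mirrorPoly (edgeFactor (x , y)) ⊗ mirrorPoly (graphPoly E)       ≡⟨ cong₂ _⊗_ mirror-edgeFactor (mirrorPoly-graphPoly E) ⟩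
  edgeFactor (mirrorEdge (x , y)) ⊗ graphPoly (map mirrorEdge E)   ∎
  where
  open ≡-Reasoning
  mirror-edgeFactor : mirrorPoly (edgeFactor (x , y)) ≡ edgeFactor (mirrorEdge (x , y))
  mirror-edgeFactor = cong₂ (λ a b → (+ 1 , a) ∷ (ℤ.- + 1 , b) ∷ []) (mirror-unitExp x) (mirror-unitExp y)

map-map-comm : ∀ {C D : Set} {f : A → B} {g : B → D} {f′ : A → C} {g′ : C → D} →
               g ∘ f ≗ g′ ∘ f′ → (xs : List A) → map g (map f xs) ≡ map g′ (map f′ xs)
map-map-comm eq xs = trans (sym (List.map-∘ xs)) (trans (List.map-cong eq xs) (List.map-∘ xs))

tabulate-∷ʳ : (f : Fin (suc n) → A) → tabulate f ≡ tabulate (f ∘ inject₁) List.∷ʳ f (fromℕ n)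
tabulate-∷ʳ {zero}  f = refl
tabulate-∷ʳ {suc n} f = cong (f zero ∷_) (tabulate-∷ʳ (f ∘ suc))

tabulate-opposite : (f : Fin n → A) → tabulate (f ∘ opposite) ≡ List.reverse (tabulate f)
tabulate-opposite {zero}  f = refl
tabulate-opposite {suc n} f = begin
  f (fromℕ n) ∷ tabulate (f ∘ inject₁ ∘ opposite)            ≡⟨ cong (f (fromℕ n) ∷_) (tabulate-opposite (f ∘ inject₁)) ⟩
  f (fromℕ n) ∷ List.reverse (tabulate (f ∘ inject₁))        ≡⟨ List.reverse-++ (tabulate (f ∘ inject₁)) List.[ f (fromℕ n) ] ⟨
  List.reverse (tabulate (f ∘ inject₁) List.∷ʳ f (fromℕ n))  ≡⟨ cong List.reverse (tabulate-∷ʳ f) ⟨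
  List.reverse (tabulate f)                                   ∎
  where open ≡-Reasoning

opposite-inject₁ : (i : Fin n) → opposite (inject₁ i) ≡ suc (opposite i)
opposite-inject₁ zero    = refl
opposite-inject₁ (suc i) = cong inject₁ (opposite-inject₁ i)

pathEdge : Fin n → Fin (suc n) × Fin (suc n)
pathEdge i = inject₁ i , suc i

pathEdges-tabulate : ∀ n → pathEdges (suc n) ≡ tabulate pathEdge
pathEdges-tabulate zero    = refl
pathEdges-tabulate (suc n) = cong (pathEdge zero ∷_) (begin
  map (Product.map suc suc) (pathEdges (suc n))   ≡⟨ cong (map (Product.map suc suc)) (pathEdges-tabulate n) ⟩
  map (Product.map suc suc) (tabulate pathEdge)   ≡⟨ List.map-tabulate pathEdge (Product.map suc suc) ⟩
  tabulate (pathEdge ∘ suc)                       ∎)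
  where open ≡-Reasoning

length-pathEdges : ∀ n → length (pathEdges n) ≡ n ℕ.∸ 1
length-pathEdges zero    = refl
length-pathEdges (suc n) = trans (cong length (pathEdges-tabulate n)) (List.length-tabulate pathEdge)

pathEdges-opposite : ∀ n → map (Product.map opposite opposite) (pathEdges n)
                           ≡ List.reverse (map flip (pathEdges n))
pathEdges-opposite zero    = refl
pathEdges-opposite (suc n) = begin
  map (Product.map opposite opposite) (pathEdges (suc n))
    ≡⟨ cong (map _) (pathEdges-tabulate n) ⟩
  map (Product.map opposite opposite) (tabulate pathEdge)
    ≡⟨ List.map-tabulate pathEdge _ ⟩
  tabulate (λ i → opposite (inject₁ i) , inject₁ (opposite i))
    ≡⟨ List.tabulate-cong (λ i → cong (_, inject₁ (opposite i)) (opposite-inject₁ i)) ⟩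
  tabulate (flip ∘ pathEdge ∘ opposite)
    ≡⟨ tabulate-opposite (flip ∘ pathEdge) ⟩
  List.reverse (tabulate (flip ∘ pathEdge))
    ≡⟨ cong List.reverse (List.map-tabulate pathEdge flip) ⟨
  List.reverse (map flip (tabulate pathEdge))
    ≡⟨ cong (List.reverse ∘ map flip) (pathEdges-tabulate n) ⟨
  List.reverse (map flip (pathEdges (suc n)))
    ∎
  where open ≡-Reasoning

spoke : Fin n → Fin (suc n) × Fin (suc n)
spoke i = zero , suc i

rimEdges : ∀ n → List (Fin (suc n) × Fin (suc n))
rimEdges n = map (Product.map suc suc) (pathEdges n)

spokes-mirror : ∀ n → map mirrorEdge (map spoke (allFin n)) ≡ List.reverse (map spoke (allFin n))
spokes-mirror n = begin
  map mirrorEdge (map spoke (tabulate id))   ≡⟨ cong (map mirrorEdge) (List.map-tabulate id spoke) ⟩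
  map mirrorEdge (tabulate spoke)            ≡⟨ List.map-tabulate spoke mirrorEdge ⟩
  tabulate (spoke ∘ opposite)                ≡⟨ tabulate-opposite spoke ⟩
  List.reverse (tabulate spoke)              ≡⟨ cong List.reverse (List.map-tabulate id spoke) ⟨
  List.reverse (map spoke (tabulate id))     ∎
  where open ≡-Reasoning

rimEdges-mirror : ∀ n → map mirrorEdge (rimEdges n) ≡ List.reverse (map flip (rimEdges n))
rimEdges-mirror n = begin
  map mirrorEdge (map (Product.map suc suc) (pathEdges n))
    ≡⟨ map-map-comm (λ _ → refl) (pathEdges n) ⟩
  map (Product.map suc suc) (map (Product.map opposite opposite) (pathEdges n))
    ≡⟨ cong (map _) (pathEdges-opposite n) ⟩
  map (Product.map suc suc) (List.reverse (map flip (pathEdges n)))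
    ≡⟨ List.reverse-map _ (map flip (pathEdges n)) ⟩
  List.reverse (map (Product.map suc suc) (map flip (pathEdges n)))
    ≡⟨ cong List.reverse (map-map-comm (λ _ → refl) (pathEdges n)) ⟩
  List.reverse (map flip (map (Product.map suc suc) (pathEdges n)))
    ∎
  where open ≡-Reasoning

fanEdges-mirror : ∀ n → map mirrorEdge (fanEdges n) ↭ map spoke (allFin n) ++ map flip (rimEdges n)
fanEdges-mirror n = ↭-trans
  (↭-reflexive (trans (List.map-++ mirrorEdge (map spoke (allFin n)) (rimEdges n))
                      (cong₂ _++_ (spokes-mirror n) (rimEdges-mirror n))))
  (++⁺ (↭-reverse (map spoke (allFin n))) (↭-reverse (map flip (rimEdges n))))

fanPoly-mirror : ∀ n (e : Monomial (suc n)) →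
                 coeff (fanPoly n) (mirror e) ≡ neg^ (n ℕ.∸ 1) (coeff (fanPoly n) e)
fanPoly-mirror n e = begin
  coeff (fanPoly n) (mirror e)
    ≡⟨ coeff-mirrorPoly (fanPoly n) e ⟨
  coeff (mirrorPoly (fanPoly n)) e
    ≡⟨ cong (λ p → coeff p e) (mirrorPoly-graphPoly (fanEdges n)) ⟩
  coeff (graphPoly (map mirrorEdge (fanEdges n))) e
    ≡⟨ graphPoly-↭ (fanEdges-mirror n) .coeff-≈ e ⟩
  coeff (graphPoly (map spoke (allFin n) ++ map flip (rimEdges n))) e
    ≡⟨ graphPoly-flip (map spoke (allFin n)) (rimEdges n) .coeff-≈ e ⟩
  neg^ (length (rimEdges n)) (coeff (fanPoly n) e)
    ≡⟨ cong (λ k → neg^ k (coeff (fanPoly n) e)) rim-length ⟩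
  neg^ (n ℕ.∸ 1) (coeff (fanPoly n) e)
    ∎
  where
  open ≡-Reasoning
  rim-length : length (rimEdges n) ≡ n ℕ.∸ 1
  rim-length = trans (List.length-map _ (pathEdges n)) (length-pathEdges n)

lemma4p2 : (k : ℕ) → 1 ≤ k → (αu : ℕ) (α : Vec ℕ (2 * k)) (η : ℤ)
    → coeff (fanPoly (2 * k)) (αu ∷ α) ≡ η → η ≢ + 0
    → coeff (fanPoly (2 * k)) (αu ∷ reverse α) ≡ - η
-- The sign identity holds for every coefficient, so η ≢ + 0 is not needed.
lemma4p2 k 1≤k αu α η coeff≡η _ = begin
  coeff (fanPoly (2 * k)) (mirror (αu ∷ α))             ≡⟨ fanPoly-mirror (2 * k) (αu ∷ α) ⟩
  neg^ (2 * k ℕ.∸ 1) (coeff (fanPoly (2 * k)) (αu ∷ α))  ≡⟨ cong (neg^ (2 * k ℕ.∸ 1)) coeff≡η ⟩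
  neg^ (2 * k ℕ.∸ 1) η                                  ≡⟨ neg^-odd k 1≤k η ⟩
  - η                                                   ∎
  where open ≡-Reasoning
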